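{- Let $\omega=\frac{ -1+\sqrt{ -3}}{2}$, $\mathcal{O}_K=\mathbb{Z}+\mathbb{Z}\omega$, and for $\alpha,\beta\in\mathbb{C}$ let $[\alpha,\beta]=\begin{pmatrix}1&\alpha&\beta\\0&1&\bar\alpha\\0&0&1\end{pmatrix}$. Let $N(\mathcal{O}_K)=\{[\alpha,\beta]:\alpha,\beta\in\mathcal{O}_K,\ \beta+\bar\beta=\alpha\bar\alpha\}$. Then $N(\mathcal{O}_K)$ is the group generated by $$T_1=\begin{pmatrix}1&1&-\omega\\0&1&1\\0&0&1\end{pmatrix},\qquad T_2=\begin{pmatrix}1&\omega&-\omega\\0&1&\bar\omega\\0&0&1\end{pmatrix}.$$
   Context: $N(\mathcal{O}_K)$ is a group under matrix multiplication (it is the intersection of the unipotent radical of the upper triangular parabolic subgroup of $U(2,1)=\{g\in GL(3,\mathbb{C}):g^*Jg=J\}$, $J=\begin{pmatrix}0&0&1\\0&-1&0\\1&0&0\end{pmatrix}$, with $U(2,1;\mathcal{O}_K)$). -}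

module Defs where

open import Data.Integer using (ℤ; +_; -_) renaming (_+_ to _+ℤ_; _*_ to _*ℤ_; _-_ to _-ℤ_)
open import Data.Fin using (Fin; zero; suc)
open import Data.Vec using (Vec; []; _∷_; lookup; tabulate)
open import Data.Product using (Σ; _×_; ∃₂)
open import Relation.Binary.PropositionalEquality using (_≡_)

-- Eisenstein integers O_K = ℤ + ℤω, ω = (-1+√-3)/2, ω² = -1 - ω.
-- mkE a b represents a + bω.
record E : Set where
  constructor mkE
  field
    re : ℤ
    om : ℤ

0E 1E ωE : E
0E = mkE (+ 0) (+ 0)
1E = mkE (+ 1) (+ 0)
ωE = mkE (+ 0) (+ 1)

_+E_ : E → E → E
mkE a b +E mkE c d = mkE (a +ℤ c) (b +ℤ d)

-E_ : E → E
-E mkE a b = mkE (- a) (- b)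

_*E_ : E → E → E
mkE a b *E mkE c d = mkE (a *ℤ c -ℤ b *ℤ d) (a *ℤ d +ℤ b *ℤ c -ℤ b *ℤ d)

-- complex conjugation: conj(a+bω) = a + b ω̄ = a + b(-1-ω) = (a-b) - bω
conj : E → E
conj (mkE a b) = mkE (a -ℤ b) (- b)

Mat3 : Set
Mat3 = Vec (Vec E 3) 3

entry : Mat3 → Fin 3 → Fin 3 → E
entry M i j = lookup (lookup M i) j

_·_ : Mat3 → Mat3 → Mat3
M · N = tabulate λ i → tabulate λ j →
  ((entry M i zero *E entry N zero j) +E (entry M i (suc zero) *E entry N (suc zero) j)) +E (entry M i (suc (suc zero)) *E entry N (suc (suc zero)) j)

I₃ : Mat3
I₃ = (1E ∷ 0E ∷ 0E ∷ []) ∷ (0E ∷ 1E ∷ 0E ∷ []) ∷ (0E ∷ 0E ∷ 1E ∷ []) ∷ []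

bracket : E → E → Mat3
bracket α β = (1E ∷ α ∷ β ∷ []) ∷ (0E ∷ 1E ∷ conj α ∷ []) ∷ (0E ∷ 0E ∷ 1E ∷ []) ∷ []

InN : Mat3 → Set
InN M = ∃₂ λ α β → (M ≡ bracket α β) × (β +E conj β ≡ α *E conj α)

T₁ T₂ : Mat3
T₁ = (1E ∷ 1E ∷ (-E ωE) ∷ []) ∷ (0E ∷ 1E ∷ 1E ∷ []) ∷ (0E ∷ 0E ∷ 1E ∷ []) ∷ []
T₂ = (1E ∷ ωE ∷ (-E ωE) ∷ []) ∷ (0E ∷ 1E ∷ conj ωE ∷ []) ∷ (0E ∷ 0E ∷ 1E ∷ []) ∷ []

data IsGen : Mat3 → Set where
  gen₁ : IsGen T₁
  gen₂ : IsGen T₂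

-- subgroup of GL(3) generated by T₁, T₂: smallest set containing I,
-- closed under left multiplication by a generator and by its inverse
-- (X is the inverse of generator T when X · T ≡ I₃, equivalently T · X ≡ I₃).
-- Equivalently: all finite words in T₁^{±1}, T₂^{±1}.
data Generated : Mat3 → Set where
  gen-id  : Generated I₃
  gen-mul : ∀ {T M} → IsGen T → Generated M → Generated (T · M)
  gen-inv : ∀ {T X M} → IsGen T → X · T ≡ I₃ → T · X ≡ I₃ → Generated M → Generated (X · M)

{-# OPTIONS --safe #-}
-- Multiplying out gives [α, β] [γ, δ] = [α + γ, β + δ + α γ̄], and the defining condition
-- β + β̄ = α ᾱ of N(O_K) is preserved by this product and by the inverse [α, β]⁻¹ = [-α, β̄].
-- Since T₁ = [1, -ω] and T₂ = [ω, -ω] lie in N(O_K), so does every word in T₁^{±1}, T₂^{±1}.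
-- Conversely, left multiplication by T₁^{±1}, T₂^{±1} moves the first coordinate α by ±1, ±ω
-- while staying inside N(O_K), so induction on the coordinates of α ∈ ℤ + ℤω reduces
-- everything to α = 0. The elements [0, β] of N(O_K) are those with β + β̄ = 0, i.e. β ∈ ℤ√-3,
-- and these are the powers of the commutator [T₂, T₁] = [0, ω - ω̄] = [0, √-3].
module Submission where

open import Defs
open import Function.Bundles using (_⇔_; mk⇔)

open import Algebra.Bundles using (Monoid)
import Algebra.Properties.Monoid as MonoidProperties
open import Data.Fin using (Fin; zero; suc; _↑ˡ_; _↑ʳ_; combine)
open import Data.Integer as ℤ using (ℤ; +_; -[1+_]; 0ℤ; 1ℤ; -1ℤ)
import Data.Integer.Properties as ℤₚ
import Data.Integer.Tactic.RingSolver as ℤ-Ring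
open import Data.Nat as ℕ using (ℕ)
open import Data.Product using (_×_; _,_; proj₁; proj₂)
open import Data.Vec using (Vec; _∷_; []; lookup; tabulate; map; _++_; concat)
open import Data.Vec.Properties using (∷-injectiveˡ; ∷-injectiveʳ)
open import Function.Base using (_∘′_)
open import Level using (0ℓ)
open import Relation.Binary.PropositionalEquality
open ≡-Reasoning
open import Tactic.RingSolver.NonReflective ℤ-Ring.ring using (Expr; Κ; Ι; _⊕_; _⊗_; ⊝_; module Ops)
open import Tactic.RingSolver.Core.Polynomial.Parameters using (module Homomorphism)
open import Tactic.RingSolver.Core.Polynomial.Base (Homomorphism.from Ops.homo) using (Poly)
open import Tactic.RingSolver.Core.Polynomial.Semantics Ops.homo using () renaming (⟦_⟧ to ⟦_⟧ₚ)

-- An `E-Expr n` is an element of ℤ[ω] whose two coordinates are integer polynomial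
-- expressions in the coordinates of n variables. Its operations, and those on matrices of
-- such expressions, copy the clauses of Defs, so that evaluation commutes with them
-- definitionally; an identity between evaluated expressions then follows once the
-- coordinates have equal normal forms, which `refl` checks by computation.
record E-Expr (n : ℕ) : Set where
  constructor mkExpr
  field
    re om : Expr ℤ (n ℕ.+ n)

module _ {n : ℕ} where

  0ₑ 1ₑ : E-Expr n
  0ₑ = mkExpr (Κ (+ 0)) (Κ (+ 0))
  1ₑ = mkExpr (Κ (+ 1)) (Κ (+ 0))

  _+ₑ_ _*ₑ_ : E-Expr n → E-Expr n → E-Expr n
  mkExpr a b +ₑ mkExpr c d = mkExpr (a ⊕ c) (b ⊕ d)
  mkExpr a b *ₑ mkExpr c d = mkExpr (a ⊗ c ⊕ ⊝ (b ⊗ d)) (a ⊗ d ⊕ b ⊗ c ⊕ ⊝ (b ⊗ d))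

  -ₑ_ conjₑ : E-Expr n → E-Expr n
  -ₑ mkExpr a b = mkExpr (⊝ a) (⊝ b)
  conjₑ (mkExpr a b) = mkExpr (a ⊕ ⊝ b) (⊝ b)

  X : Fin n → E-Expr n
  X i = mkExpr (Ι (i ↑ˡ n)) (Ι (n ↑ʳ i))

  coordinates : Vec E n → Vec ℤ (n ℕ.+ n)
  coordinates xs = map E.re xs ++ map E.om xs

  ⟦_⟧ : E-Expr n → Vec E n → E
  ⟦ mkExpr a b ⟧ xs = mkE (Ops.⟦ a ⟧ (coordinates xs)) (Ops.⟦ b ⟧ (coordinates xs))

  normal-form : E-Expr n → Poly (n ℕ.+ n) × Poly (n ℕ.+ n)
  normal-form (mkExpr a b) = Ops.norm a , Ops.norm b

  E-solve : ∀ p q → normal-form p ≡ normal-form q → ∀ xs → ⟦ p ⟧ xs ≡ ⟦ q ⟧ xs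
  E-solve (mkExpr a b) (mkExpr c d) nf≡ xs =
    cong₂ mkE (coordinate a c (cong proj₁ nf≡)) (coordinate b d (cong proj₂ nf≡))
    where
    ρ : Vec ℤ (n ℕ.+ n)
    ρ = coordinates xs
    coordinate : ∀ a c → Ops.norm a ≡ Ops.norm c → Ops.⟦ a ⟧ ρ ≡ Ops.⟦ c ⟧ ρ
    coordinate a c nf≡ = begin
      Ops.⟦ a ⟧ ρ        ≡⟨ Ops.correct a ρ ⟨
      ⟦ Ops.norm a ⟧ₚ ρ  ≡⟨ cong (λ p → ⟦ p ⟧ₚ ρ) nf≡ ⟩
      ⟦ Ops.norm c ⟧ₚ ρ  ≡⟨ Ops.correct c ρ ⟩
      Ops.⟦ c ⟧ ρ        ∎

  E-solve-rows : ∀ {k m} (P Q : Vec (Vec (E-Expr n) k) m) →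
                 map (map normal-form) P ≡ map (map normal-form) Q →
                 ∀ xs → map (map λ p → ⟦ p ⟧ xs) P ≡ map (map λ p → ⟦ p ⟧ xs) Q
  E-solve-rows [] [] nf≡ xs = refl
  E-solve-rows (p ∷ P) (q ∷ Q) nf≡ xs =
    cong₂ _∷_ (row p q (∷-injectiveˡ nf≡)) (E-solve-rows P Q (∷-injectiveʳ nf≡) xs)
    where
    row : ∀ {k} (p q : Vec (E-Expr n) k) → map normal-form p ≡ map normal-form q →
          map (λ p → ⟦ p ⟧ xs) p ≡ map (λ p → ⟦ p ⟧ xs) q
    row [] [] nf≡ = refl
    row (a ∷ p) (b ∷ q) nf≡ = cong₂ _∷_ (E-solve a b (∷-injectiveˡ nf≡) xs) (row p q (∷-injectiveʳ nf≡))

  Mat-Expr : Set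
  Mat-Expr = Vec (Vec (E-Expr n) 3) 3

  entryₑ : Mat-Expr → Fin 3 → Fin 3 → E-Expr n
  entryₑ M i j = lookup (lookup M i) j

  _·ₑ_ : Mat-Expr → Mat-Expr → Mat-Expr
  M ·ₑ N = tabulate λ i → tabulate λ j →
    ((entryₑ M i zero *ₑ entryₑ N zero j) +ₑ (entryₑ M i (suc zero) *ₑ entryₑ N (suc zero) j)) +ₑ
    (entryₑ M i (suc (suc zero)) *ₑ entryₑ N (suc (suc zero)) j)

  I₃ₑ : Mat-Expr
  I₃ₑ = (1ₑ ∷ 0ₑ ∷ 0ₑ ∷ []) ∷ (0ₑ ∷ 1ₑ ∷ 0ₑ ∷ []) ∷ (0ₑ ∷ 0ₑ ∷ 1ₑ ∷ []) ∷ []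

  bracketₑ : E-Expr n → E-Expr n → Mat-Expr
  bracketₑ α β = (1ₑ ∷ α ∷ β ∷ []) ∷ (0ₑ ∷ 1ₑ ∷ conjₑ α ∷ []) ∷ (0ₑ ∷ 0ₑ ∷ 1ₑ ∷ []) ∷ []

  variable-matrix : (Fin 3 → Fin 3 → Fin n) → Mat-Expr
  variable-matrix v = tabulate λ i → tabulate λ j → X (v i j)

pattern 3×3 = (_ ∷ _ ∷ _ ∷ []) ∷ (_ ∷ _ ∷ _ ∷ []) ∷ (_ ∷ _ ∷ _ ∷ []) ∷ []

·-assoc : ∀ A B C → (A · B) · C ≡ A · (B · C)
·-assoc A@3×3 B@3×3 C@3×3 =
  E-solve-rows ((𝔸 ·ₑ 𝔹) ·ₑ ℂ) (𝔸 ·ₑ (𝔹 ·ₑ ℂ)) refl (concat A ++ concat B ++ concat C)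
  where
  𝔸 𝔹 ℂ : Mat-Expr {27}
  𝔸 = variable-matrix λ i j → combine i j ↑ˡ 18
  𝔹 = variable-matrix λ i j → 9 ↑ʳ (combine i j ↑ˡ 9)
  ℂ = variable-matrix λ i j → 18 ↑ʳ combine i j

·-identityˡ : ∀ M → I₃ · M ≡ M
·-identityˡ M@3×3 = E-solve-rows (I₃ₑ ·ₑ 𝕄) 𝕄 refl (concat M)
  where
  𝕄 : Mat-Expr {9}
  𝕄 = variable-matrix combine

·-identityʳ : ∀ M → M · I₃ ≡ M
·-identityʳ M@3×3 = E-solve-rows (𝕄 ·ₑ I₃ₑ) 𝕄 refl (concat M)
  where
  𝕄 : Mat-Expr {9}
  𝕄 = variable-matrix combine

Mat3-monoid : Monoid 0ℓ 0ℓ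
Mat3-monoid = record
  { Carrier = Mat3 ; _≈_ = _≡_ ; _∙_ = _·_ ; ε = I₃
  ; isMonoid = record
    { isSemigroup = record
      { isMagma = record { isEquivalence = isEquivalence ; ∙-cong = cong₂ _·_ }
      ; assoc = ·-assoc }
    ; identity = ·-identityˡ , ·-identityʳ } }

open MonoidProperties Mat3-monoid using (insertʳ; cancelˡ)

trace : E → E
trace x = x +E conj x

-- The condition g* J g = J for g = [α, β].
IsUnitary : E → E → Set
IsUnitary α β = trace β ≡ α *E conj α

traceₑ : ∀ {n} → E-Expr n → E-Expr n
traceₑ p = p +ₑ conjₑ p

private
  X₀ : ∀ {n} → E-Expr (ℕ.suc n)
  X₀ = X zero
  X₁ : ∀ {n} → E-Expr (ℕ.suc (ℕ.suc n))
  X₁ = X (suc zero)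

-E-inverseʳ : ∀ x → x +E (-E x) ≡ 0E
-E-inverseʳ x = E-solve (X₀ +ₑ (-ₑ X₀)) 0ₑ refl (x ∷ [])

-E-cancelˡ : ∀ x y → (-E x) +E (x +E y) ≡ y
-E-cancelˡ x y = E-solve ((-ₑ X₀) +ₑ (X₀ +ₑ X₁)) X₁ refl (x ∷ y ∷ [])

trace-+ : ∀ x y → trace (x +E y) ≡ trace x +E trace y
trace-+ x y = E-solve (traceₑ (X₀ +ₑ X₁)) (traceₑ X₀ +ₑ traceₑ X₁) refl (x ∷ y ∷ [])

trace-conj : ∀ x → trace (conj x) ≡ trace x
trace-conj x = E-solve (traceₑ (conjₑ X₀)) (traceₑ X₀) refl (x ∷ [])

norm-+ : ∀ x y → (x +E y) *E conj (x +E y) ≡ ((x *E conj x) +E (y *E conj y)) +E trace (x *E conj y)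
norm-+ x y = E-solve ((X₀ +ₑ X₁) *ₑ conjₑ (X₀ +ₑ X₁))
                     (((X₀ *ₑ conjₑ X₀) +ₑ (X₁ *ₑ conjₑ X₁)) +ₑ traceₑ (X₀ *ₑ conjₑ X₁))
                     refl (x ∷ y ∷ [])

norm-neg : ∀ x → (-E x) *E conj (-E x) ≡ x *E conj x
norm-neg x = E-solve ((-ₑ X₀) *ₑ conjₑ (-ₑ X₀)) (X₀ *ₑ conjₑ X₀) refl (x ∷ [])

*-conj-neg : ∀ x → x *E conj (-E x) ≡ -E (x *E conj x)
*-conj-neg x = E-solve (X₀ *ₑ conjₑ (-ₑ X₀)) (-ₑ (X₀ *ₑ conjₑ X₀)) refl (x ∷ [])

bracket-· : ∀ α β γ δ → bracket α β · bracket γ δ ≡ bracket (α +E γ) ((β +E δ) +E (α *E conj γ))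
bracket-· α β γ δ =
  E-solve-rows (bracketₑ A B ·ₑ bracketₑ C D) (bracketₑ (A +ₑ C) ((B +ₑ D) +ₑ (A *ₑ conjₑ C)))
               refl (α ∷ β ∷ γ ∷ δ ∷ [])
  where
  A B C D : E-Expr 4
  A = X zero
  B = X (suc zero)
  C = X (suc (suc zero))
  D = X (suc (suc (suc zero)))

IsUnitary-· : ∀ {α β γ δ} → IsUnitary α β → IsUnitary γ δ →
              IsUnitary (α +E γ) ((β +E δ) +E (α *E conj γ))
IsUnitary-· {α} {β} {γ} {δ} αβ γδ = begin
  trace ((β +E δ) +E (α *E conj γ))                       ≡⟨ trace-+ (β +E δ) (α *E conj γ) ⟩
  trace (β +E δ) +E trace (α *E conj γ)                   ≡⟨ cong (_+E trace (α *E conj γ)) (trace-+ β δ) ⟩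
  (trace β +E trace δ) +E trace (α *E conj γ)             ≡⟨ cong (_+E trace (α *E conj γ)) (cong₂ _+E_ αβ γδ) ⟩
  ((α *E conj α) +E (γ *E conj γ)) +E trace (α *E conj γ) ≡⟨ norm-+ α γ ⟨
  (α +E γ) *E conj (α +E γ)                               ∎

IsUnitary-inverse : ∀ {α β} → IsUnitary α β → IsUnitary (-E α) (conj β)
IsUnitary-inverse {α} {β} αβ = trans (trace-conj β) (trans αβ (sym (norm-neg α)))

bracket-inverseʳ : ∀ {α β} → IsUnitary α β → bracket α β · bracket (-E α) (conj β) ≡ I₃
bracket-inverseʳ {α} {β} αβ = trans (bracket-· α β (-E α) (conj β)) (cong₂ bracket (-E-inverseʳ α) (begin
  trace β +E (α *E conj (-E α))       ≡⟨ cong₂ _+E_ αβ (*-conj-neg α) ⟩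
  (α *E conj α) +E (-E (α *E conj α)) ≡⟨ -E-inverseʳ (α *E conj α) ⟩
  0E                                  ∎))

InN-· : ∀ {M N} → InN M → InN N → InN (M · N)
InN-· (α , β , refl , αβ) (γ , δ , refl , γδ) =
  α +E γ , (β +E δ) +E (α *E conj γ) , bracket-· α β γ δ , IsUnitary-· {α} {β} {γ} {δ} αβ γδ

InN-left-inverse : ∀ {T X} → InN T → X · T ≡ I₃ → InN X
InN-left-inverse {X = X} (α , β , refl , αβ) X·T≡I₃ =
  -E α , conj β , X≡T⁻¹ , IsUnitary-inverse {α} {β} αβ
  where
  T⁻¹ : Mat3
  T⁻¹ = bracket (-E α) (conj β)
  X≡T⁻¹ : X ≡ T⁻¹
  X≡T⁻¹ = begin
    X                       ≡⟨ insertʳ {a = bracket α β} {c = T⁻¹} (bracket-inverseʳ {α} {β} αβ) X ⟩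
    (X · bracket α β) · T⁻¹ ≡⟨ cong (_· T⁻¹) X·T≡I₃ ⟩
    I₃ · T⁻¹                ≡⟨ ·-identityˡ T⁻¹ ⟩
    T⁻¹                     ∎

IsGen⇒InN : ∀ {T} → IsGen T → InN T
IsGen⇒InN gen₁ = 1E , -E ωE , refl , refl
IsGen⇒InN gen₂ = ωE , -E ωE , refl , refl

Generated⇒InN : ∀ {M} → Generated M → InN M
Generated⇒InN gen-id = 0E , 0E , refl , refl
Generated⇒InN (gen-mul {T} {M} T∈ p) = InN-· {T} {M} (IsGen⇒InN T∈) (Generated⇒InN p)
Generated⇒InN (gen-inv {T} {X} {M} T∈ X·T≡I₃ _ p) =
  InN-· {X} {M} (InN-left-inverse {T} {X} (IsGen⇒InN T∈) X·T≡I₃) (Generated⇒InN p)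

Generated-· : ∀ {A B} → Generated A → Generated B → Generated (A · B)
Generated-· {B = B} gen-id q = subst Generated (sym (·-identityˡ B)) q
Generated-· {B = B} (gen-mul {T} {M} T∈ p) q =
  subst Generated (sym (·-assoc T M B)) (gen-mul T∈ (Generated-· p q))
Generated-· {B = B} (gen-inv {T} {X} {M} T∈ X·T≡I₃ T·X≡I₃ p) q =
  subst Generated (sym (·-assoc X M B)) (gen-inv {X = X} T∈ X·T≡I₃ T·X≡I₃ (Generated-· p q))

T₁⁻¹ T₂⁻¹ : Mat3
T₁⁻¹ = bracket (-E 1E) (conj (-E ωE))
T₂⁻¹ = bracket (-E ωE) (conj (-E ωE))

Generated-T₁ : Generated T₁
Generated-T₁ = gen-mul gen₁ gen-id

Generated-T₂ : Generated T₂
Generated-T₂ = gen-mul gen₂ gen-id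

Generated-T₁⁻¹ : Generated T₁⁻¹
Generated-T₁⁻¹ = gen-inv {X = T₁⁻¹} gen₁ refl refl gen-id

Generated-T₂⁻¹ : Generated T₂⁻¹
Generated-T₂⁻¹ = gen-inv {X = T₂⁻¹} gen₂ refl refl gen-id

ℤ-induction : ∀ {p} (P : ℤ → Set p) → P 0ℤ →
              (∀ i → P i → P (ℤ.suc i)) → (∀ i → P i → P (ℤ.pred i)) → ∀ i → P i
ℤ-induction P P0 Psuc Ppred (+ ℕ.zero)    = P0
ℤ-induction P P0 Psuc Ppred (+ ℕ.suc n)   = Psuc (+ n) (ℤ-induction P P0 Psuc Ppred (+ n))
ℤ-induction P P0 Psuc Ppred -[1+ ℕ.zero ]  = Ppred 0ℤ P0
ℤ-induction P P0 Psuc Ppred -[1+ ℕ.suc n ] = Ppred -[1+ n ] (ℤ-induction P P0 Psuc Ppred -[1+ n ])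

-- central u = [0, u √-3], as 1 + 2ω = √-3.
central : ℤ → Mat3
central u = bracket 0E (mkE u (u ℤ.+ u))

central-· : ∀ i j → central i · central j ≡ central (i ℤ.+ j)
central-· i j = trans (bracket-· 0E (mkE i (i ℤ.+ i)) 0E (mkE j (j ℤ.+ j)))
                      (cong (bracket 0E) (cong₂ mkE (re≡ i j) (om≡ i j)))
  where
  re≡ : ∀ i j → (i ℤ.+ j) ℤ.+ 0ℤ ≡ i ℤ.+ j
  re≡ = ℤ-Ring.solve-∀
  om≡ : ∀ i j → ((i ℤ.+ i) ℤ.+ (j ℤ.+ j)) ℤ.+ 0ℤ ≡ (i ℤ.+ j) ℤ.+ (i ℤ.+ j)
  om≡ = ℤ-Ring.solve-∀

Generated-central : ∀ u → Generated (central u)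
Generated-central = ℤ-induction (λ u → Generated (central u)) gen-id
  (λ u p → subst Generated (central-· 1ℤ u) (Generated-· commutator p))
  (λ u p → subst Generated (central-· -1ℤ u) (Generated-· commutator⁻¹ p))
  where
  commutator : Generated (central 1ℤ)
  commutator =
    Generated-· Generated-T₂ (Generated-· Generated-T₁ (Generated-· Generated-T₂⁻¹ Generated-T₁⁻¹))
  commutator⁻¹ : Generated (central -1ℤ)
  commutator⁻¹ =
    Generated-· Generated-T₁ (Generated-· Generated-T₂ (Generated-· Generated-T₁⁻¹ Generated-T₂⁻¹))

GeneratedFibre : E → Set
GeneratedFibre α = ∀ β → IsUnitary α β → Generated (bracket α β)

GeneratedFibre-0E : GeneratedFibre 0E
GeneratedFibre-0E (mkE u v) trace≡0 =
  subst (λ v → Generated (bracket 0E (mkE u v))) (sym v≡2u) (Generated-central u)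
  where
  v-from-trace : ∀ u v → v ≡ (u ℤ.+ u) ℤ.- (u ℤ.+ (u ℤ.- v))
  v-from-trace = ℤ-Ring.solve-∀
  v≡2u : v ≡ u ℤ.+ u
  v≡2u = begin
    v                                  ≡⟨ v-from-trace u v ⟩
    (u ℤ.+ u) ℤ.- (u ℤ.+ (u ℤ.- v))    ≡⟨ cong (λ x → (u ℤ.+ u) ℤ.- x) (cong E.re trace≡0) ⟩
    (u ℤ.+ u) ℤ.- 0ℤ                   ≡⟨ ℤₚ.+-identityʳ (u ℤ.+ u) ⟩
    u ℤ.+ u                            ∎

-- [α₀ + γ, β] = g · (g⁻¹ · [α₀ + γ, β]) with g = [α₀, β₀], and g⁻¹ · [α₀ + γ, β] lies over γ.
GeneratedFibre-step : ∀ {α₀ β₀} → Generated (bracket α₀ β₀) → IsUnitary α₀ β₀ →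
                      ∀ {γ} → GeneratedFibre γ → GeneratedFibre (α₀ +E γ)
GeneratedFibre-step {α₀} {β₀} g α₀β₀ {γ} fibre β αβ =
  subst Generated (cancelˡ {a = bracket α₀ β₀} {c = g⁻¹} (bracket-inverseʳ {α₀} {β₀} α₀β₀) M)
        (Generated-· g (subst Generated (sym g⁻¹M≡) (fibre β′ γβ′)))
  where
  g⁻¹ : Mat3
  g⁻¹ = bracket (-E α₀) (conj β₀)
  M : Mat3
  M = bracket (α₀ +E γ) β
  β′ : E
  β′ = (conj β₀ +E β) +E ((-E α₀) *E conj (α₀ +E γ))
  g⁻¹M≡ : g⁻¹ · M ≡ bracket γ β′
  g⁻¹M≡ = trans (bracket-· (-E α₀) (conj β₀) (α₀ +E γ) β) (cong (λ α → bracket α β′) (-E-cancelˡ α₀ γ))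
  γβ′ : IsUnitary γ β′
  γβ′ = subst (λ α → IsUnitary α β′) (-E-cancelˡ α₀ γ)
              (IsUnitary-· { -E α₀} {conj β₀} {α₀ +E γ} {β} (IsUnitary-inverse {α₀} {β₀} α₀β₀) αβ)

GeneratedFibre-all : ∀ α → GeneratedFibre α
GeneratedFibre-all (mkE a b) = ℤ-induction (λ b → GeneratedFibre (mkE a b)) (GeneratedFibre-real a)
  (λ b → drop-+0 (ℤ.suc b) ∘′ GeneratedFibre-step {ωE} { -E ωE} Generated-T₂ refl)
  (λ b → drop-+0 (ℤ.pred b) ∘′ GeneratedFibre-step { -E ωE} {conj (-E ωE)} Generated-T₂⁻¹ refl) b
  where
  GeneratedFibre-real : ∀ a → GeneratedFibre (mkE a 0ℤ)
  GeneratedFibre-real = ℤ-induction (λ a → GeneratedFibre (mkE a 0ℤ)) GeneratedFibre-0E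
    (λ _ → GeneratedFibre-step {1E} { -E ωE} Generated-T₁ refl)
    (λ _ → GeneratedFibre-step { -E 1E} {conj (-E ωE)} Generated-T₁⁻¹ refl)
  drop-+0 : ∀ b → GeneratedFibre (mkE (+ 0 ℤ.+ a) b) → GeneratedFibre (mkE a b)
  drop-+0 b = subst (λ x → GeneratedFibre (mkE x b)) (ℤₚ.+-identityˡ a)

InN⇒Generated : ∀ {M} → InN M → Generated M
InN⇒Generated (α , β , refl , αβ) = GeneratedFibre-all α β αβ

theorem3p1 : ∀ (M : Mat3) → InN M ⇔ Generated M
theorem3p1 M = mk⇔ InN⇒Generated Generated⇒InN
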